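{- It is not true in general that $w_{\lambda^{ -1}}(i)\prec w_{\lambda^{ -1}}(j)$ implies $x_i\prec x_j$: there exist a totally ordered alphabet, a word $x$ over it, and positions $i,j$ of $x$ such that $w_{\lambda^{ -1}}(i)\prec w_{\lambda^{ -1}}(j)$ but $x_i\succ x_j$.
   Context: For a totally ordered alphabet $(\Sigma,<)$, the lexicographic order $\prec$ on words is: $u\prec v$ iff either $v=uw$ for some non-empty word $w$, or $u=ary$, $v=asy'$ for words $a,y,y'$ and letters $r<s$. For a word $x[1..n]$ and $1\le i\le n$, $x_i=x[i..n]$. A non-empty word $w$ is an inverse Lyndon word if $s\prec w$ for every non-empty proper suffix $s$ of $w$. The inverse Lyndon array is $\lambda^{ -1}[i]=\max\{m\in[1,n-i+1]\mid x[i..i+m-1]\text{ is an inverse Lyndon word}\}$, and $w_{\lambda^{ -1}}(i)=x[i..i+\lambda^{ -1}[i]-1]$ is the maximal inverse Lyndon subword starting at $i$. -}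

module Defs where

open import Level using (Level)
open import Data.Nat using (ℕ; suc; _+_; _≤_; _<_)
open import Data.List using (List; []; _∷_; _++_; length; take; drop)
open import Relation.Binary.Core using (Rel)
open import Relation.Binary.PropositionalEquality using (_≢_)

data Lex {a ℓ : Level} {A : Set a} (_<ₐ_ : Rel A ℓ) : List A → List A → Set (Level._⊔_ a ℓ) where
  prefix : (u : List A) (c : A) (w : List A) → Lex _<ₐ_ u (u ++ (c ∷ w))
  differ : (p : List A) (r s : A) (y y′ : List A) → r <ₐ s →
           Lex _<ₐ_ (p ++ (r ∷ y)) (p ++ (s ∷ y′))

IsInverseLyndon : {a ℓ : Level} {A : Set a} (_<ₐ_ : Rel A ℓ) → List A → Set (Level._⊔_ a ℓ)
IsInverseLyndon _<ₐ_ w = (w ≢ []) × ((k : ℕ) → 1 ≤ k → k < length w → Lex _<ₐ_ (drop k w) w)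
  where open import Data.Product using (_×_)

-- Factor x[i .. i+m-1] (positions 0-indexed here).
factor : {a : Level} {A : Set a} → List A → ℕ → ℕ → List A
factor x i m = take m (drop i x)

IsInvLyndonArrayValue : {a ℓ : Level} {A : Set a} (_<ₐ_ : Rel A ℓ) →
                        List A → ℕ → ℕ → Set (Level._⊔_ a ℓ)
IsInvLyndonArrayValue _<ₐ_ x i m =
  (1 ≤ m) × (i + m ≤ length x) × IsInverseLyndon _<ₐ_ (factor x i m) ×
  ((m′ : ℕ) → 1 ≤ m′ → i + m′ ≤ length x → IsInverseLyndon _<ₐ_ (factor x i m′) → m′ ≤ m)
  where open import Data.Product using (_×_)

{-# OPTIONS --safe #-}
-- Over the alphabet 0 < 1 take x = 001. From position 0 the maximal inverse
-- Lyndon factor is 00, from position 1 it is 0: an inverse Lyndon word starts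
-- with its largest letter, so neither 001 nor 01 qualifies. Then 0 ≺ 00, yet
-- x₀ = 001 ≺ 01 = x₁.
module Submission where

open import Defs
open import Level using (Level; 0ℓ)
open import Data.Nat using (ℕ; zero; suc; _+_; _∸_; _<_; _≤_; s≤s; z≤n)
open import Data.Nat.Properties using (<-strictTotalOrder; <-asym; <⇒≤; ∸-monoʳ-<; ≤-refl)
open import Data.List using (List; []; _∷_; _++_; length; drop; replicate)
open import Data.List.Properties using (length-replicate)
open import Data.Product using (Σ; _×_; _,_)
open import Data.Sum using (_⊎_; inj₁; inj₂)
open import Relation.Binary.Core using (Rel)
open import Relation.Binary.Definitions using (Asymmetric)
open import Relation.Binary.Bundles using (StrictTotalOrder)
open import Relation.Binary.PropositionalEquality using (_≡_; refl; subst)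
open import Relation.Nullary using (¬_; contradiction)

drop-replicate : ∀ {a} {A : Set a} (k n : ℕ) (c : A) →
                 drop k (replicate n c) ≡ replicate (n ∸ k) c
drop-replicate zero    n       c = refl
drop-replicate (suc k) zero    c = refl
drop-replicate (suc k) (suc n) c = drop-replicate k n c

drop-suc-length-++ : ∀ {a} {A : Set a} (c : A) (u v : List A) →
                     drop (suc (length u)) (c ∷ u ++ v) ≡ v
drop-suc-length-++ c []      v = refl
drop-suc-length-++ c (d ∷ u) v = drop-suc-length-++ d u v

length<length-++-∷ : ∀ {a} {A : Set a} (u : List A) (c : A) (v : List A) →
                     length u < length (u ++ c ∷ v)
length<length-++-∷ []      c v = s≤s z≤n
length<length-++-∷ (d ∷ u) c v = s≤s (length<length-++-∷ u c v)

module _ {a ℓ : Level} {A : Set a} {_<ₐ_ : Rel A ℓ} where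

  Lex-∷ : ∀ {u v} (c : A) → Lex _<ₐ_ u v → Lex _<ₐ_ (c ∷ u) (c ∷ v)
  Lex-∷ c (prefix u d w)          = prefix (c ∷ u) d w
  Lex-∷ c (differ p r s y y′ r<s) = differ (c ∷ p) r s y y′ r<s

  -- Index equations, because unifying p ++ r ∷ y with c ∷ u′ is stuck until p is split.
  Lex-head : ∀ {u v} → Lex _<ₐ_ u v →
             ∀ {c d u′ v′} → u ≡ c ∷ u′ → v ≡ d ∷ v′ → c <ₐ d ⊎ c ≡ d
  Lex-head (prefix u e w) {c} {d} {u′} {v′} = prefix-head u
    where
    prefix-head : ∀ u → u ≡ c ∷ u′ → u ++ e ∷ w ≡ d ∷ v′ → c <ₐ d ⊎ c ≡ d
    prefix-head (_ ∷ _) refl refl = inj₂ refl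
  Lex-head (differ p r s y y′ r<s) {c} {d} {u′} {v′} = differ-head p
    where
    differ-head : ∀ p → p ++ r ∷ y ≡ c ∷ u′ → p ++ s ∷ y′ ≡ d ∷ v′ → c <ₐ d ⊎ c ≡ d
    differ-head []      refl refl = inj₁ r<s
    differ-head (_ ∷ _) refl refl = inj₂ refl

  ¬Lex-∷-> : Asymmetric _<ₐ_ → ∀ {c d u v} → d <ₐ c → ¬ Lex _<ₐ_ (c ∷ u) (d ∷ v)
  ¬Lex-∷-> asym d<c lex with Lex-head lex refl refl
  ... | inj₁ c<d  = asym c<d d<c
  ... | inj₂ refl = asym d<c d<c

  replicate-Lex : ∀ {m n} (c : A) → m < n → Lex _<ₐ_ (replicate m c) (replicate n c)
  replicate-Lex {zero}  {suc n} c _         = prefix [] c (replicate n c)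
  replicate-Lex {suc m} {suc n} c (s≤s m<n) = Lex-∷ c (replicate-Lex c m<n)

  replicate-isInverseLyndon : ∀ n (c : A) → IsInverseLyndon _<ₐ_ (replicate (suc n) c)
  replicate-isInverseLyndon n c = (λ ()) , proper-suffix-Lex
    where
    proper-suffix-Lex : ∀ k → 1 ≤ k → k < length (replicate (suc n) c) →
                        Lex _<ₐ_ (drop k (replicate (suc n) c)) (replicate (suc n) c)
    proper-suffix-Lex k 1≤k k<len
      rewrite drop-replicate k (suc n) c | length-replicate (suc n) {c}
      = replicate-Lex c (∸-monoʳ-< 1≤k (<⇒≤ k<len))

  -- The suffix starting at the occurrence of d would begin with a letter above c.
  isInverseLyndon⇒¬head< : Asymmetric _<ₐ_ → ∀ {c d} u v →
                           IsInverseLyndon _<ₐ_ (c ∷ u ++ d ∷ v) → ¬ c <ₐ d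
  isInverseLyndon⇒¬head< asym {c} {d} u v (_ , suffix-Lex) c<d =
    ¬Lex-∷-> asym c<d (subst (λ s → Lex _<ₐ_ s (c ∷ u ++ d ∷ v))
                             (drop-suc-length-++ c u (d ∷ v))
                             (suffix-Lex (suc (length u)) (s≤s z≤n)
                                         (s≤s (length<length-++-∷ u d v))))

x₀₀₁ : List ℕ
x₀₀₁ = 0 ∷ 0 ∷ 1 ∷ []

λ⁻¹[0]≡2 : IsInvLyndonArrayValue _<_ x₀₀₁ 0 2
λ⁻¹[0]≡2 = s≤s z≤n , s≤s (s≤s z≤n) , replicate-isInverseLyndon 1 0 , maximal
  where
  maximal : ∀ m → 1 ≤ m → m ≤ 3 → IsInverseLyndon _<_ (factor x₀₀₁ 0 m) → m ≤ 2
  maximal 1 _ _ _ = s≤s z≤n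
  maximal 2 _ _ _ = ≤-refl
  maximal 3 _ _ 001-isInverseLyndon =
    contradiction (s≤s z≤n) (isInverseLyndon⇒¬head< <-asym (0 ∷ []) [] 001-isInverseLyndon)
  maximal (suc (suc (suc (suc _)))) _ (s≤s (s≤s (s≤s ())))

λ⁻¹[1]≡1 : IsInvLyndonArrayValue _<_ x₀₀₁ 1 1
λ⁻¹[1]≡1 = s≤s z≤n , s≤s (s≤s z≤n) , replicate-isInverseLyndon 0 0 , maximal
  where
  maximal : ∀ m → 1 ≤ m → 1 + m ≤ 3 → IsInverseLyndon _<_ (factor x₀₀₁ 1 m) → m ≤ 1
  maximal 1 _ _ _ = ≤-refl
  maximal 2 _ _ 01-isInverseLyndon =
    contradiction (s≤s z≤n) (isInverseLyndon⇒¬head< <-asym [] [] 01-isInverseLyndon)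
  maximal (suc (suc (suc _))) _ (s≤s (s≤s (s≤s ())))

proposition1 :
    Σ (StrictTotalOrder 0ℓ 0ℓ 0ℓ) λ O →
      Σ (List (StrictTotalOrder.Carrier O)) λ x →
        Σ ℕ λ i → Σ ℕ λ j → Σ ℕ λ mi → Σ ℕ λ mj →
          (i < length x) × (j < length x) ×
          IsInvLyndonArrayValue (StrictTotalOrder._<_ O) x i mi ×
          IsInvLyndonArrayValue (StrictTotalOrder._<_ O) x j mj ×
          Lex (StrictTotalOrder._<_ O) (factor x i mi) (factor x j mj) ×
          Lex (StrictTotalOrder._<_ O) (drop j x) (drop i x)
proposition1 =
  <-strictTotalOrder , x₀₀₁ , 1 , 0 , 1 , 2 ,
  s≤s (s≤s z≤n) , s≤s z≤n ,
  λ⁻¹[1]≡1 , λ⁻¹[0]≡2 ,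
  replicate-Lex 0 (s≤s (s≤s z≤n)) ,
  differ (0 ∷ []) 0 1 (1 ∷ []) [] (s≤s z≤n)
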